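{- Let $k\geq 0$ and let $P$ be a parallelogram polyomino. Then $P$ is $k$-parallelogram (i.e. $k$-convex) if and only if at least one of the paths $v(P)$, $h(P)$ has at most $k$ changes of direction.
   Context: A polyomino is a finite edge-connected union of unit cells of $\mathbb{Z}^2$; it is convex if all rows and columns are connected; a parallelogram polyomino is one whose boundary consists of two north/east lattice paths with common endpoints, otherwise disjoint. $S$ and $E$ denote its lower leftmost and upper rightmost cells. An internal path is a sequence of distinct cells with consecutive cells edge-adjacent, each consecutive pair forming a north, south, east or west step; it is monotone if all its steps lie in one of $\{n,e\},\{n,w\},\{s,e\},\{s,w\}$; a change of direction is a pair of consecutive steps of different types; a side is a maximal run of equal steps. A convex polyomino is $k$-convex if any two of its cells are joined by a monotone internal path with at most $k$ changes of direction; a $k$-parallelogram polyomino is a $k$-convex parallelogram polyomino. The horizontal path $h(P)$ is the internal path from $S$ to $E$ starting with an east step in which every side has maximal length (east as far as possible inside $P$, then north as far as possible, etc.); $v(P)$ is defined likewise starting with a north step. If $S$ has no cell of $P$ above it, $v(P)$ is defined to equal $h(P)$; if $S$ has no cell of $P$ to its right, $h(P)$ is defined to equal $v(P)$. -}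

module Defs where

open import Data.Nat using (ℕ; zero; suc; _+_; _≤_; _<_)
open import Data.Integer as ℤ using (ℤ; +_)
open import Data.Bool using (Bool; true; false; if_then_else_)
open import Data.Maybe using (Maybe; just; nothing)
open import Data.List using (List; []; _∷_)
open import Data.List.Relation.Unary.All using (All)
open import Data.List.Relation.Unary.Unique.Propositional using (Unique)
open import Data.List.Membership.Propositional using (_∈_)
open import Data.Product using (Σ; _×_; _,_; proj₁; proj₂; ∃)
open import Data.Sum using (_⊎_)
open import Data.Unit using (⊤)
open import Relation.Nullary using (¬_)
open import Relation.Binary.PropositionalEquality using (_≡_)
open import Function.Bundles using (_⇔_)

-- Cells and lattice points of ℤ² (a cell is named by its lower-left corner)

Cell : Set
Cell = ℤ × ℤ

data Dir : Set where
  n s e w : Dir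

mv : Dir → Cell → Cell
mv n (x , y) = (x , y ℤ.+ + 1)
mv s (x , y) = (x , y ℤ.- + 1)
mv e (x , y) = (x ℤ.+ + 1 , y)
mv w (x , y) = (x ℤ.- + 1 , y)

same : Dir → Dir → Bool
same n n = true
same s s = true
same e e = true
same w w = true
same _ _ = false

trace : Cell → List Dir → List Cell
trace c []       = c ∷ []
trace c (d ∷ ds) = c ∷ trace (mv d c) ds

endOf : Cell → List Dir → Cell
endOf c []       = c
endOf c (d ∷ ds) = endOf (mv d c) ds

InternalPath : (Cell → Set) → Cell → List Dir → Set
InternalPath P c ds = All P (trace c ds) × Unique (trace c ds)

_∈₂_ : Dir → Dir × Dir → Set
d ∈₂ (a , b) = d ≡ a ⊎ d ≡ b

Monotone : List Dir → Set
Monotone ds = All (_∈₂ (n , e)) ds ⊎ All (_∈₂ (n , w)) ds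
            ⊎ All (_∈₂ (s , e)) ds ⊎ All (_∈₂ (s , w)) ds

changes : List Dir → ℕ
changes (a ∷ b ∷ ds) = (if same a b then 0 else 1) + changes (b ∷ ds)
changes _            = 0

Finite : (Cell → Set) → Set
Finite P = Σ (List Cell) λ L → ∀ c → P c → c ∈ L

Connected : (Cell → Set) → Set
Connected P = ∀ c d → P c → P d →
  Σ (List Dir) λ ds → InternalPath P c ds × endOf c ds ≡ d

IsPolyomino : (Cell → Set) → Set
IsPolyomino P = Finite P × (Σ Cell P) × Connected P

ColumnsConnected : (Cell → Set) → Set
ColumnsConnected P = ∀ x y₁ y₂ y → P (x , y₁) → P (x , y₂) →
  y₁ ℤ.≤ y → y ℤ.≤ y₂ → P (x , y)

RowsConnected : (Cell → Set) → Set
RowsConnected P = ∀ y x₁ x₂ x → P (x₁ , y) → P (x₂ , y) →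
  x₁ ℤ.≤ x → x ℤ.≤ x₂ → P (x , y)

IsConvexPolyomino : (Cell → Set) → Set
IsConvexPolyomino P = IsPolyomino P × RowsConnected P × ColumnsConnected P

Joins : ℕ → (Cell → Set) → Cell → Cell → Set
Joins k P c d = Σ (List Dir) λ ds →
  InternalPath P c ds × endOf c ds ≡ d × Monotone ds × changes ds ≤ k

KConvex : ℕ → (Cell → Set) → Set
KConvex k P = IsConvexPolyomino P × (∀ c d → P c → P d → Joins k P c d)

IsNE : Dir → Set
IsNE d = d ∈₂ (n , e)

-- For a north/east lattice path started at height y (relative),
-- eh y ds x = height of its east step in the x-th column (relative).
eh : ℕ → List Dir → ℕ → Maybe ℕ
eh y []       x       = nothing
eh y (n ∷ ds) x       = eh (suc y) ds x
eh y (e ∷ ds) zero    = just y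
eh y (e ∷ ds) (suc x) = eh y ds x
eh y (s ∷ ds) x       = nothing
eh y (w ∷ ds) x       = nothing

-- the cell c lies in the region enclosed between the upper N/E path u
-- and the lower N/E path l, both starting at the lattice point o
Inside : Cell → List Dir → List Dir → Cell → Set
Inside (ox , oy) u l (cx , cy) = Σ ℕ λ x → Σ ℕ λ y → Σ ℕ λ a → Σ ℕ λ b →
  cx ≡ ox ℤ.+ + x × cy ≡ oy ℤ.+ + y ×
  eh 0 l x ≡ just a × eh 0 u x ≡ just b × a ≤ y × y < b

-- boundary = two north/east lattice paths with common endpoints,
-- otherwise disjoint; P = the cells they enclose
IsParallelogram : (Cell → Set) → Set
IsParallelogram P = IsPolyomino P × Σ Cell λ o → Σ (List Dir) λ u → Σ (List Dir) λ l →
  All IsNE u × All IsNE l × endOf o u ≡ endOf o l ×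
  (∀ p → p ∈ trace o u → p ∈ trace o l → p ≡ o ⊎ p ≡ endOf o u) ×
  (∀ c → P c ⇔ Inside o u l c)

KParallelogram : ℕ → (Cell → Set) → Set
KParallelogram k P = KConvex k P × IsParallelogram P

IsS : (Cell → Set) → Cell → Set
IsS P c = P c × (∀ d → P d → proj₁ c ℤ.≤ proj₁ d × proj₂ c ℤ.≤ proj₂ d)

IsE : (Cell → Set) → Cell → Set
IsE P c = P c × (∀ d → P d → proj₁ d ℤ.≤ proj₁ c × proj₂ d ℤ.≤ proj₂ c)

HeadIs : Dir → List Dir → Set
HeadIs d []      = ⊤
HeadIs d (a ∷ _) = a ≡ d

-- every side has maximal length: at the end of each side (cell c reached
-- by the last step a of the side), the next cell in direction a is not in P
MaximalSides : (Cell → Set) → Cell → List Dir → Set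
MaximalSides P c []           = ⊤
MaximalSides P c (a ∷ [])     = ¬ P (mv a (mv a c))
MaximalSides P c (a ∷ b ∷ ds) =
  (if same a b then ⊤ else ¬ P (mv a (mv a c))) × MaximalSides P (mv a c) (b ∷ ds)

Greedy : (Cell → Set) → Cell → Cell → Dir → List Dir → Set
Greedy P S E d ds = InternalPath P S ds × endOf S ds ≡ E ×
  All IsNE ds × HeadIs d ds × MaximalSides P S ds

-- h(P): starts east; equals v(P) if S has no cell of P to its right
IsH : (Cell → Set) → Cell → Cell → List Dir → Set
IsH P S E ds = (P (mv e S) × Greedy P S E e ds) ⊎ (¬ P (mv e S) × Greedy P S E n ds)

-- v(P): starts north; equals h(P) if S has no cell of P above it
IsV : (Cell → Set) → Cell → Cell → List Dir → Set
IsV P S E ds = (P (mv n S) × Greedy P S E n ds) ⊎ (¬ P (mv n S) × Greedy P S E e ds)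

module Submission where

-- A parallelogram polyomino is row- and
-- column-convex and closed under the staircase move (with c north-west of d,
-- the cell in c's row and d's column lies in P).  In such a set a north-east
-- guide path from S to E can be shadowed: any c ≼ d are joined by a north-east
-- path with no more changes than the guide.  Sufficiency: shadow v(P) or h(P)
-- for north-east pairs, use the staircase corner (one east run, one south run)
-- for north-west pairs, and reverse routes for the other two positions.
-- Necessity: a monotone route from S to E is north-east, and greedification
-- (go straight on whenever P allows, justified again by shadowing) turns it
-- into v(P) or h(P) without new changes.

open import Defs
open import Data.Nat as ℕ using (ℕ; zero; suc; z≤n; s≤s; _≤_)
import Data.Nat.Properties as ℕP
open import Data.Integer as ℤ using (ℤ; +_)
import Data.Integer.Properties as ℤP
open import Data.Integer.Tactic.RingSolver using (solve-∀)
open import Algebra.Bundles using (AbelianGroup)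
open import Algebra.Properties.Group (AbelianGroup.group ℤP.+-0-abelianGroup) using (∙-cancelˡ)
open import Data.Bool using (true; false; if_then_else_)
open import Data.Maybe using (just; nothing)
open import Data.Maybe.Properties using (just-injective)
open import Data.List using (List; []; _∷_; _++_; replicate; length)
open import Data.List.Properties using (++-identityʳ)
open import Data.List.Relation.Unary.All as All using (All; []; _∷_)
open import Data.List.Relation.Unary.All.Properties using (++⁺; replicate⁺)
open import Data.List.Relation.Unary.Any using (here; there)
open import Data.List.Relation.Unary.AllPairs using ([]; _∷_)
open import Data.List.Relation.Unary.Unique.Propositional using (Unique)
open import Data.List.Membership.Propositional using (_∈_)
open import Data.Product using (Σ; _×_; _,_; proj₁; proj₂)
open import Data.Sum using (_⊎_; inj₁; inj₂)
open import Data.Unit using (⊤; tt)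
open import Data.Empty using (⊥-elim)
open import Relation.Nullary using (¬_; Dec; yes; no)
open import Relation.Nullary.Decidable using (map′)
open import Relation.Binary.PropositionalEquality
open import Function.Bundles using (_⇔_; mk⇔; Equivalence)

≤⇒shift : ∀ {i j} → i ℤ.≤ j → Σ ℕ λ m → j ≡ i ℤ.+ + m
≤⇒shift {i} {j} i≤j = ℤ.∣ j ℤ.- i ∣ , (begin
    j                       ≡⟨ j≡i+[j-i] i j ⟩
    i ℤ.+ (j ℤ.- i)         ≡⟨ cong (λ t → i ℤ.+ t) (sym (ℤP.0≤i⇒+∣i∣≡i (ℤP.i≤j⇒0≤j-i i≤j))) ⟩
    i ℤ.+ + ℤ.∣ j ℤ.- i ∣   ∎)
  where
  open ≡-Reasoning
  j≡i+[j-i] : ∀ i j → j ≡ i ℤ.+ (j ℤ.- i)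
  j≡i+[j-i] = solve-∀

shift-cancel : ∀ a {x y} → a ℤ.+ + x ≡ a ℤ.+ + y → x ≡ y
shift-cancel a eq = ℤP.+-injective (∙-cancelˡ a _ _ eq)

shift-cancel-≤ : ∀ a {x y} → a ℤ.+ + x ℤ.≤ a ℤ.+ + y → x ≤ y
shift-cancel-≤ a {x} {y} le =
  ℤP.drop‿+≤+ (subst₂ ℤ._≤_ (unshift a (+ x)) (unshift a (+ y)) (ℤP.+-monoʳ-≤ (ℤ.- a) le))
  where
  unshift : ∀ a x → (ℤ.- a) ℤ.+ (a ℤ.+ x) ≡ x
  unshift = solve-∀

shift-mono-≤ : ∀ a {x y} → x ≤ y → a ℤ.+ + x ℤ.≤ a ℤ.+ + y
shift-mono-≤ a x≤y = ℤP.+-monoʳ-≤ a (ℤ.+≤+ x≤y)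

shift-+ : ∀ a x m → (a ℤ.+ + x) ℤ.+ + m ≡ a ℤ.+ + (x ℕ.+ m)
shift-+ a x m = trans (ℤP.+-assoc a (+ x) (+ m)) (cong (λ t → a ℤ.+ t) (sym (ℤP.pos-+ x m)))

shift-back : ∀ y j → (y ℤ.+ j) ℤ.- j ≡ y
shift-back = solve-∀

shift-forth : ∀ y j → (y ℤ.- j) ℤ.+ j ≡ y
shift-forth = solve-∀

i<i+1 : ∀ i → i ℤ.< i ℤ.+ + 1
i<i+1 i = ℤP.suc[i]≤j⇒i<j (ℤP.≤-reflexive (ℤP.+-comm (+ 1) i))

i-1<i : ∀ i → i ℤ.- + 1 ℤ.< i
i-1<i i = subst (i ℤ.- + 1 ℤ.<_) (shift-forth i (+ 1)) (i<i+1 (i ℤ.- + 1))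

no-room : ∀ {a b} j → a ℤ.≤ b → b ℤ.+ + j ℤ.≤ a → j ≡ 0
no-room {a} {b} j a≤b b+j≤a = ℕP.n≤0⇒n≡0 (shift-cancel-≤ b
  (ℤP.≤-trans b+j≤a (ℤP.≤-trans a≤b (ℤP.≤-reflexive (sym (ℤP.+-identityʳ b))))))

shift-zero : ∀ a {m} → a ℤ.+ + m ≡ a → m ≡ 0
shift-zero a eq = shift-cancel a (trans eq (sym (ℤP.+-identityʳ a)))

≤⇒+1≤⊎≡ : ∀ {i j} → i ℤ.≤ j → (i ℤ.+ + 1 ℤ.≤ j) ⊎ (i ≡ j)
≤⇒+1≤⊎≡ {i} {j} i≤j with i ℤP.≟ j
... | yes i≡j = inj₂ i≡j
... | no i≢j  = inj₁ (subst (ℤ._≤ j) (ℤP.+-comm (+ 1) i) (ℤP.i<j⇒suc[i]≤j (ℤP.≤∧≢⇒< i≤j i≢j)))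

turn : Dir → Dir → ℕ
turn a b = if same a b then 0 else 1

same⇒≡ : ∀ a b → same a b ≡ true → a ≡ b
same⇒≡ n n _ = refl
same⇒≡ s s _ = refl
same⇒≡ e e _ = refl
same⇒≡ w w _ = refl
same⇒≡ n s ()
same⇒≡ n e ()
same⇒≡ n w ()
same⇒≡ s n ()
same⇒≡ s e ()
same⇒≡ s w ()
same⇒≡ e n ()
same⇒≡ e s ()
same⇒≡ e w ()
same⇒≡ w n ()
same⇒≡ w s ()
same⇒≡ w e ()

turn-refl : ∀ a → turn a a ≡ 0
turn-refl n = refl
turn-refl s = refl
turn-refl e = refl
turn-refl w = refl

turn≤1 : ∀ a b → turn a b ≤ 1
turn≤1 a b with same a b
... | true  = z≤n
... | false = s≤s z≤n

turn≡0⇒≡ : ∀ a b → turn a b ≡ 0 → a ≡ b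
turn≡0⇒≡ a b turn≡0 with same a b in eq
... | true = same⇒≡ a b eq

turn-triangle : ∀ h a b → turn h b ≤ turn h a ℕ.+ turn a b
turn-triangle h a b with same h a in eq
... | false = ℕP.≤-trans (turn≤1 h b) (s≤s z≤n)
... | true with refl ← same⇒≡ h a eq = ℕP.≤-refl

changes-delete : ∀ h a ds → changes (h ∷ ds) ≤ changes (h ∷ a ∷ ds)
changes-delete h a []       = z≤n
changes-delete h a (b ∷ ds) =
  subst (turn h b ℕ.+ changes (b ∷ ds) ≤_) (ℕP.+-assoc (turn h a) (turn a b) (changes (b ∷ ds)))
    (ℕP.+-monoˡ-≤ (changes (b ∷ ds)) (turn-triangle h a b))

changes-tail : ∀ h ds → changes ds ≤ changes (h ∷ ds)
changes-tail h []       = z≤n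
changes-tail h (b ∷ ds) = ℕP.m≤n+m _ _

changes-dup : ∀ a ds → changes (a ∷ a ∷ ds) ≡ changes (a ∷ ds)
changes-dup a ds = cong (ℕ._+ changes (a ∷ ds)) (turn-refl a)

leading : Dir → List Dir → Dir
leading a []      = a
leading _ (b ∷ _) = b

changes-leading : ∀ a ds → changes (leading a ds ∷ ds) ≡ changes ds
changes-leading a []       = refl
changes-leading a (b ∷ ds) = changes-dup b ds

changes-run : ∀ a j → changes (a ∷ replicate j a) ≡ 0
changes-run a zero    = refl
changes-run a (suc j) = trans (changes-dup a (replicate j a)) (changes-run a j)

changes≡0⇒constant : ∀ a ds → changes (a ∷ ds) ≡ 0 → All (_≡ a) ds
changes≡0⇒constant a []       _  = []
changes≡0⇒constant a (b ∷ ds) eq with refl ← turn≡0⇒≡ a b (ℕP.m+n≡0⇒m≡0 (turn a b) eq) =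
  refl ∷ changes≡0⇒constant a ds (ℕP.m+n≡0⇒n≡0 (turn a a) eq)

changes-replicate : ∀ a j → changes (replicate j a) ≡ 0
changes-replicate a zero    = refl
changes-replicate a (suc j) = changes-run a j

changes-two-runs : ∀ a b m j → changes (replicate m a ++ replicate j b) ≤ 1
changes-two-runs a b zero          j       = subst (_≤ 1) (sym (changes-replicate b j)) z≤n
changes-two-runs a b (suc zero)    zero    = z≤n
changes-two-runs a b (suc zero)    (suc j) =
  subst (λ t → turn a b ℕ.+ t ≤ 1) (sym (changes-run b j))
    (subst (_≤ 1) (sym (ℕP.+-identityʳ (turn a b))) (turn≤1 a b))
changes-two-runs a b (suc (suc m)) j       =
  subst (_≤ 1) (sym (changes-dup a (replicate m a ++ replicate j b))) (changes-two-runs a b (suc m) j)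

_≼_ : Cell → Cell → Set
(a , b) ≼ (c , d) = a ℤ.≤ c × b ℤ.≤ d

≼-trans : ∀ {p q r} → p ≼ q → q ≼ r → p ≼ r
≼-trans (a , b) (c , d) = ℤP.≤-trans a c , ℤP.≤-trans b d

≼-antisym : ∀ {p q} → p ≼ q → q ≼ p → p ≡ q
≼-antisym (a , b) (c , d) = cong₂ _,_ (ℤP.≤-antisym a c) (ℤP.≤-antisym b d)

≼-step : ∀ a c → IsNE a → c ≼ mv a c
≼-step .n (x , y) (inj₁ refl) = ℤP.≤-refl , ℤP.<⇒≤ (i<i+1 y)
≼-step .e (x , y) (inj₂ refl) = ℤP.<⇒≤ (i<i+1 x) , ℤP.≤-refl

trace-head : ∀ c ds → c ∈ trace c ds
trace-head c []      = here refl
trace-head c (_ ∷ _) = here refl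

All-head : ∀ {P : Cell → Set} c ds → All P (trace c ds) → P c
All-head c []      (pc ∷ _) = pc
All-head c (_ ∷ _) (pc ∷ _) = pc

endOf-++ : ∀ c xs ys → endOf c (xs ++ ys) ≡ endOf (endOf c xs) ys
endOf-++ c []       ys = refl
endOf-++ c (a ∷ xs) ys = endOf-++ (mv a c) xs ys

All-trace-++ : ∀ {P : Cell → Set} c xs ys →
  All P (trace c xs) → All P (trace (endOf c xs) ys) → All P (trace c (xs ++ ys))
All-trace-++ c []       ys _          q = q
All-trace-++ c (a ∷ xs) ys (pc ∷ pxs) q = pc ∷ All-trace-++ (mv a c) xs ys pxs q

endOf-run-e : ∀ j x y → endOf (x , y) (replicate j e) ≡ (x ℤ.+ + j , y)
endOf-run-e zero    x y = cong (_, y) (sym (ℤP.+-identityʳ x))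
endOf-run-e (suc j) x y =
  trans (endOf-run-e j (x ℤ.+ + 1) y) (cong (_, y) (shift-+ x 1 j))

endOf-run-n : ∀ j x y → endOf (x , y) (replicate j n) ≡ (x , y ℤ.+ + j)
endOf-run-n zero    x y = cong (x ,_) (sym (ℤP.+-identityʳ y))
endOf-run-n (suc j) x y =
  trans (endOf-run-n j x (y ℤ.+ + 1)) (cong (x ,_) (shift-+ y 1 j))

endOf-run-s : ∀ j x y → endOf (x , y) (replicate j s) ≡ (x , y ℤ.- + j)
endOf-run-s zero    x y = cong (x ,_) (sym (ℤP.+-identityʳ y))
endOf-run-s (suc j) x y = trans (endOf-run-s j x (y ℤ.- + 1)) (cong (x ,_) (unshift y j))
  where
  unshift : ∀ y j → (y ℤ.- + 1) ℤ.- + j ≡ y ℤ.- + suc j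
  unshift y j = trans (ℤP.+-assoc y (ℤ.- + 1) (ℤ.- + j))
    (cong (λ t → y ℤ.+ t) (trans (sym (ℤP.neg-distrib-+ (+ 1) (+ j))) (cong ℤ.-_ (sym (ℤP.pos-+ 1 j)))))

row-of-east-run : ∀ c ds → All (_≡ e) ds → proj₂ (endOf c ds) ≡ proj₂ c
row-of-east-run c        []       _          = refl
row-of-east-run (x , y) (.e ∷ ds) (refl ∷ r) = row-of-east-run (x ℤ.+ + 1 , y) ds r

column-of-north-run : ∀ c ds → All (_≡ n) ds → proj₁ (endOf c ds) ≡ proj₁ c
column-of-north-run c        []       _          = refl
column-of-north-run (x , y) (.n ∷ ds) (refl ∷ r) = column-of-north-run (x , y ℤ.+ + 1) ds r

-- Monotone paths are automatically self-avoiding: each of the four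
-- monotone step classes strictly increases a linear potential.

Ascends : (Cell → ℤ) → Dir → Set
Ascends φ a = ∀ z → φ z ℤ.< φ (mv a z)

ascends-by-one : ∀ φ a → (∀ z → φ (mv a z) ≡ φ z ℤ.+ + 1) → Ascends φ a
ascends-by-one φ a step z = subst (φ z ℤ.<_) (sym (step z)) (i<i+1 (φ z))

ascending-above : ∀ φ c ds → All (Ascends φ) ds → All (λ z → φ c ℤ.≤ φ z) (trace c ds)
ascending-above φ c []       _          = ℤP.≤-refl ∷ []
ascending-above φ c (a ∷ ds) (up ∷ ups) =
  ℤP.≤-refl ∷ All.map (ℤP.≤-trans (ℤP.<⇒≤ (up c))) (ascending-above φ (mv a c) ds ups)

ascending⇒unique : ∀ φ c ds → All (Ascends φ) ds → Unique (trace c ds)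
ascending⇒unique φ c []       _          = [] ∷ []
ascending⇒unique φ c (a ∷ ds) (up ∷ ups) =
  All.map (λ {z} above c≡z → ℤP.<-irrefl (cong φ c≡z) (ℤP.<-≤-trans (up c) above))
          (ascending-above φ (mv a c) ds ups)
  ∷ ascending⇒unique φ (mv a c) ds ups

φ-ne φ-nw φ-se φ-sw : Cell → ℤ
φ-ne (x , y) = x ℤ.+ y
φ-nw (x , y) = y ℤ.- x
φ-se (x , y) = x ℤ.- y
φ-sw (x , y) = ℤ.- x ℤ.- y

φ-ne-step : ∀ a z → IsNE a → φ-ne (mv a z) ≡ φ-ne z ℤ.+ + 1
φ-ne-step .n (x , y) (inj₁ refl) = north x y
  where north : ∀ x y → x ℤ.+ (y ℤ.+ + 1) ≡ (x ℤ.+ y) ℤ.+ + 1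
        north = solve-∀
φ-ne-step .e (x , y) (inj₂ refl) = east x y
  where east : ∀ x y → (x ℤ.+ + 1) ℤ.+ y ≡ (x ℤ.+ y) ℤ.+ + 1
        east = solve-∀

ascends-nw : ∀ {a} → a ∈₂ (n , w) → Ascends φ-nw a
ascends-nw (inj₁ refl) = ascends-by-one φ-nw n λ (x , y) → north x y
  where north : ∀ x y → (y ℤ.+ + 1) ℤ.- x ≡ (y ℤ.- x) ℤ.+ + 1
        north = solve-∀
ascends-nw (inj₂ refl) = ascends-by-one φ-nw w λ (x , y) → west x y
  where west : ∀ x y → y ℤ.- (x ℤ.- + 1) ≡ (y ℤ.- x) ℤ.+ + 1
        west = solve-∀

ascends-se : ∀ {a} → a ∈₂ (s , e) → Ascends φ-se a
ascends-se (inj₁ refl) = ascends-by-one φ-se s λ (x , y) → south x y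
  where south : ∀ x y → x ℤ.- (y ℤ.- + 1) ≡ (x ℤ.- y) ℤ.+ + 1
        south = solve-∀
ascends-se (inj₂ refl) = ascends-by-one φ-se e λ (x , y) → east x y
  where east : ∀ x y → (x ℤ.+ + 1) ℤ.- y ≡ (x ℤ.- y) ℤ.+ + 1
        east = solve-∀

ascends-sw : ∀ {a} → a ∈₂ (s , w) → Ascends φ-sw a
ascends-sw (inj₁ refl) = ascends-by-one φ-sw s λ (x , y) → south x y
  where south : ∀ x y → ℤ.- x ℤ.- (y ℤ.- + 1) ≡ (ℤ.- x ℤ.- y) ℤ.+ + 1
        south = solve-∀
ascends-sw (inj₂ refl) = ascends-by-one φ-sw w λ (x , y) → west x y
  where west : ∀ x y → ℤ.- (x ℤ.- + 1) ℤ.- y ≡ (ℤ.- x ℤ.- y) ℤ.+ + 1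
        west = solve-∀

monotone⇒unique : ∀ c ds → Monotone ds → Unique (trace c ds)
monotone⇒unique c ds (inj₁ ne) =
  ascending⇒unique φ-ne c ds (All.map (λ {a} isNE → ascends-by-one φ-ne a λ z → φ-ne-step a z isNE) ne)
monotone⇒unique c ds (inj₂ (inj₁ nw))        = ascending⇒unique φ-nw c ds (All.map ascends-nw nw)
monotone⇒unique c ds (inj₂ (inj₂ (inj₁ se))) = ascending⇒unique φ-se c ds (All.map ascends-se se)
monotone⇒unique c ds (inj₂ (inj₂ (inj₂ sw))) = ascending⇒unique φ-sw c ds (All.map ascends-sw sw)

ne-length : ∀ c p → All IsNE p → φ-ne (endOf c p) ≡ φ-ne c ℤ.+ + length p
ne-length c []       []           = sym (ℤP.+-identityʳ _)
ne-length c (a ∷ p) (isNE ∷ isNEs) = begin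
  φ-ne (endOf (mv a c) p)                ≡⟨ ne-length (mv a c) p isNEs ⟩
  φ-ne (mv a c) ℤ.+ + length p           ≡⟨ cong (ℤ._+ + length p) (φ-ne-step a c isNE) ⟩
  (φ-ne c ℤ.+ + 1) ℤ.+ + length p        ≡⟨ shift-+ (φ-ne c) 1 (length p) ⟩
  φ-ne c ℤ.+ + suc (length p)            ∎
  where open ≡-Reasoning

ne-length-determined : ∀ c p q → All IsNE p → All IsNE q → endOf c p ≡ endOf c q → length p ≡ length q
ne-length-determined c p q isNEp isNEq same-end = shift-cancel (φ-ne c)
  (trans (sym (ne-length c p isNEp)) (trans (cong φ-ne same-end) (ne-length c q isNEq)))

opp : Dir → Dir
opp n = s
opp s = n
opp e = w
opp w = e

mv-opp : ∀ a c → mv (opp a) (mv a c) ≡ c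
mv-opp n (x , y) = cong (x ,_) (shift-back y (+ 1))
mv-opp s (x , y) = cong (x ,_) (shift-forth y (+ 1))
mv-opp e (x , y) = cong (_, y) (shift-back x (+ 1))
mv-opp w (x , y) = cong (_, y) (shift-forth x (+ 1))

turn-opp : ∀ a b → turn (opp b) (opp a) ≡ turn a b
turn-opp n n = refl
turn-opp n s = refl
turn-opp n e = refl
turn-opp n w = refl
turn-opp s n = refl
turn-opp s s = refl
turn-opp s e = refl
turn-opp s w = refl
turn-opp e n = refl
turn-opp e s = refl
turn-opp e e = refl
turn-opp e w = refl
turn-opp w n = refl
turn-opp w s = refl
turn-opp w e = refl
turn-opp w w = refl

revOnto : List Dir → List Dir → List Dir
revOnto []       acc = acc
revOnto (a ∷ xs) acc = revOnto xs (opp a ∷ acc)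

revOnto-end : ∀ c xs acc → endOf (endOf c xs) (revOnto xs acc) ≡ endOf c acc
revOnto-end c []       acc = refl
revOnto-end c (a ∷ xs) acc =
  trans (revOnto-end (mv a c) xs (opp a ∷ acc)) (cong (λ t → endOf t acc) (mv-opp a c))

revOnto-cells : ∀ c xs acc z → z ∈ trace (endOf c xs) (revOnto xs acc) → z ∈ trace c xs ⊎ z ∈ trace c acc
revOnto-cells c []       acc z z∈ = inj₂ z∈
revOnto-cells c (a ∷ xs) acc z z∈ with revOnto-cells (mv a c) xs (opp a ∷ acc) z z∈
... | inj₁ z∈xs          = inj₁ (there z∈xs)
... | inj₂ (here refl)   = inj₁ (there (trace-head (mv a c) xs))
... | inj₂ (there z∈acc) = inj₂ (subst (λ t → z ∈ trace t acc) (mv-opp a c) z∈acc)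

revOnto-changes : ∀ a xs acc →
  changes (revOnto xs (opp a ∷ acc)) ≡ changes (a ∷ xs) ℕ.+ changes (opp a ∷ acc)
revOnto-changes a []       acc = refl
revOnto-changes a (b ∷ xs) acc = begin
  changes (revOnto xs (opp b ∷ opp a ∷ acc))
    ≡⟨ revOnto-changes b xs (opp a ∷ acc) ⟩
  changes (b ∷ xs) ℕ.+ (turn (opp b) (opp a) ℕ.+ changes (opp a ∷ acc))
    ≡⟨ cong (λ t → changes (b ∷ xs) ℕ.+ (t ℕ.+ changes (opp a ∷ acc))) (turn-opp a b) ⟩
  changes (b ∷ xs) ℕ.+ (turn a b ℕ.+ changes (opp a ∷ acc))
    ≡⟨ sym (ℕP.+-assoc (changes (b ∷ xs)) (turn a b) _) ⟩
  (changes (b ∷ xs) ℕ.+ turn a b) ℕ.+ changes (opp a ∷ acc)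
    ≡⟨ cong (ℕ._+ changes (opp a ∷ acc)) (ℕP.+-comm (changes (b ∷ xs)) (turn a b)) ⟩
  changes (a ∷ b ∷ xs) ℕ.+ changes (opp a ∷ acc) ∎
  where open ≡-Reasoning

reverse-changes : ∀ xs → changes (revOnto xs []) ≡ changes xs
reverse-changes []       = refl
reverse-changes (a ∷ xs) = trans (revOnto-changes a xs []) (ℕP.+-identityʳ _)

revOnto-All : ∀ {Q R : Dir → Set} → (∀ {a} → Q a → R (opp a)) →
  ∀ xs acc → All Q xs → All R acc → All R (revOnto xs acc)
revOnto-All f []       acc _        r = r
revOnto-All f (a ∷ xs) acc (q ∷ qs) r = revOnto-All f xs (opp a ∷ acc) qs (f q ∷ r)

reverse-monotone : ∀ xs → Monotone xs → Monotone (revOnto xs [])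
reverse-monotone xs (inj₁ ne)               = inj₂ (inj₂ (inj₂ (revOnto-All ne→sw xs [] ne [])))
  where ne→sw : ∀ {a} → a ∈₂ (n , e) → opp a ∈₂ (s , w)
        ne→sw (inj₁ refl) = inj₁ refl
        ne→sw (inj₂ refl) = inj₂ refl
reverse-monotone xs (inj₂ (inj₁ nw))        = inj₂ (inj₂ (inj₁ (revOnto-All nw→se xs [] nw [])))
  where nw→se : ∀ {a} → a ∈₂ (n , w) → opp a ∈₂ (s , e)
        nw→se (inj₁ refl) = inj₁ refl
        nw→se (inj₂ refl) = inj₂ refl
reverse-monotone xs (inj₂ (inj₂ (inj₁ se))) = inj₂ (inj₁ (revOnto-All se→nw xs [] se []))
  where se→nw : ∀ {a} → a ∈₂ (s , e) → opp a ∈₂ (n , w)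
        se→nw (inj₁ refl) = inj₁ refl
        se→nw (inj₂ refl) = inj₂ refl
reverse-monotone xs (inj₂ (inj₂ (inj₂ sw))) = inj₁ (revOnto-All sw→ne xs [] sw [])
  where sw→ne : ∀ {a} → a ∈₂ (s , w) → opp a ∈₂ (n , e)
        sw→ne (inj₁ refl) = inj₁ refl
        sw→ne (inj₂ refl) = inj₂ refl

-- A route is a monotone path inside P with at most k changes; since
-- monotone paths never revisit a cell, routes are exactly what Joins asks for.
Route : ℕ → (Cell → Set) → Cell → Cell → Set
Route k P c d = Σ (List Dir) λ ds →
  All P (trace c ds) × endOf c ds ≡ d × Monotone ds × changes ds ≤ k

route⇒joins : ∀ {k P c d} → Route k P c d → Joins k P c d
route⇒joins {c = c} (ds , inside , ends , mono , few) =
  ds , (inside , monotone⇒unique c ds mono) , ends , mono , few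

route-reverse : ∀ {k P c d} → Route k P c d → Route k P d c
route-reverse {k} {P} {c} (ds , inside , refl , mono , few) =
  revOnto ds [] ,
  All.tabulate (λ {z} z∈ → All.lookup inside (in-path z (revOnto-cells c ds [] z z∈))) ,
  revOnto-end c ds [] ,
  reverse-monotone ds mono ,
  subst (_≤ k) (sym (reverse-changes ds)) few
  where
  in-path : ∀ z → z ∈ trace c ds ⊎ z ∈ trace c [] → z ∈ trace c ds
  in-path z (inj₁ z∈)        = z∈
  in-path z (inj₂ (here refl)) = trace-head c ds

-- A monotone path that ends weakly north-east of its start is a north-east
-- path: a coordinate which never increases along the path and strictly
-- drops at a step b rules out b altogether.

descend-end : ∀ (f : Cell → ℤ) {Q : Dir → Set} → (∀ {a} → Q a → ∀ z → f (mv a z) ℤ.≤ f z) →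
  ∀ c p → All Q p → f (endOf c p) ℤ.≤ f c
descend-end f down c []       _        = ℤP.≤-refl
descend-end f down c (a ∷ p) (q ∷ qs) = ℤP.≤-trans (descend-end f down (mv a c) p qs) (down q c)

no-descent : ∀ (f : Cell → ℤ) (b : Dir) {Q : Dir → Set} →
  (∀ {a} → Q a → ∀ z → f (mv a z) ℤ.≤ f z) → (∀ z → f (mv b z) ℤ.< f z) →
  ∀ c p → All Q p → f c ℤ.≤ f (endOf c p) → All (_≢ b) p
no-descent f b down drop c []       _        _     = []
no-descent f b down drop c (a ∷ p) (q ∷ qs) rises = a≢b ∷ no-descent f b down drop (mv a c) p qs rises′
  where
  end≤next : f (endOf (mv a c) p) ℤ.≤ f (mv a c)
  end≤next = descend-end f down (mv a c) p qs
  rises′ : f (mv a c) ℤ.≤ f (endOf (mv a c) p)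
  rises′ = ℤP.≤-trans (down q c) rises
  a≢b : a ≢ b
  a≢b refl = ℤP.<-irrefl refl (ℤP.<-≤-trans (drop c) (ℤP.≤-trans rises end≤next))

x-drops-west : ∀ z → proj₁ (mv w z) ℤ.< proj₁ z
x-drops-west (x , _) = i-1<i x

y-drops-south : ∀ z → proj₂ (mv s z) ℤ.< proj₂ z
y-drops-south (_ , y) = i-1<i y

monotone-forward⇒ne : ∀ c p → Monotone p → c ≼ endOf c p → All IsNE p
monotone-forward⇒ne c p (inj₁ ne) _ = ne
monotone-forward⇒ne c p (inj₂ (inj₁ nw)) (x≤ , _) =
  All.zipWith north (nw , no-descent proj₁ w x-down x-drops-west c p nw x≤)
  where
  x-down : ∀ {a} → a ∈₂ (n , w) → ∀ z → proj₁ (mv a z) ℤ.≤ proj₁ z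
  x-down (inj₁ refl) z = ℤP.≤-refl
  x-down (inj₂ refl) z = ℤP.<⇒≤ (x-drops-west z)
  north : ∀ {a} → a ∈₂ (n , w) × a ≢ w → IsNE a
  north (inj₁ refl , _)    = inj₁ refl
  north (inj₂ refl , a≢w)  = ⊥-elim (a≢w refl)
monotone-forward⇒ne c p (inj₂ (inj₂ (inj₁ se))) (_ , y≤) =
  All.zipWith east (se , no-descent proj₂ s y-down y-drops-south c p se y≤)
  where
  y-down : ∀ {a} → a ∈₂ (s , e) → ∀ z → proj₂ (mv a z) ℤ.≤ proj₂ z
  y-down (inj₁ refl) z = ℤP.<⇒≤ (y-drops-south z)
  y-down (inj₂ refl) z = ℤP.≤-refl
  east : ∀ {a} → a ∈₂ (s , e) × a ≢ s → IsNE a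
  east (inj₁ refl , a≢s) = ⊥-elim (a≢s refl)
  east (inj₂ refl , _)   = inj₂ refl
monotone-forward⇒ne c p (inj₂ (inj₂ (inj₂ sw))) (x≤ , y≤) =
  All.zipWith impossible (All.zip (sw , no-descent proj₁ w x-down x-drops-west c p sw x≤) ,
                          no-descent proj₂ s y-down y-drops-south c p sw y≤)
  where
  x-down : ∀ {a} → a ∈₂ (s , w) → ∀ z → proj₁ (mv a z) ℤ.≤ proj₁ z
  x-down (inj₁ refl) z = ℤP.≤-refl
  x-down (inj₂ refl) z = ℤP.<⇒≤ (x-drops-west z)
  y-down : ∀ {a} → a ∈₂ (s , w) → ∀ z → proj₂ (mv a z) ℤ.≤ proj₂ z
  y-down (inj₁ refl) z = ℤP.<⇒≤ (y-drops-south z)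
  y-down (inj₂ refl) z = ℤP.≤-refl
  impossible : ∀ {a} → (a ∈₂ (s , w) × a ≢ w) × a ≢ s → IsNE a
  impossible ((inj₁ refl , _) , a≢s) = ⊥-elim (a≢s refl)
  impossible ((inj₂ refl , a≢w) , _) = ⊥-elim (a≢w refl)

eh-≥ : ∀ y₀ ds x {a} → eh y₀ ds x ≡ just a → y₀ ≤ a
eh-≥ y₀ (n ∷ ds) x       eq   = ℕP.≤-trans (ℕP.n≤1+n y₀) (eh-≥ (suc y₀) ds x eq)
eh-≥ y₀ (e ∷ ds) zero    refl = ℕP.≤-refl
eh-≥ y₀ (e ∷ ds) (suc x) eq   = eh-≥ y₀ ds x eq

eh-mono : ∀ y₀ ds {x x′ a′} → eh y₀ ds x′ ≡ just a′ → x ≤ x′ → Σ ℕ λ a → eh y₀ ds x ≡ just a × a ≤ a′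
eh-mono y₀ (n ∷ ds) eq le = eh-mono (suc y₀) ds eq le
eh-mono y₀ (e ∷ ds) {zero}  {zero}    eq _ = y₀ , refl , eh-≥ y₀ (e ∷ ds) zero eq
eh-mono y₀ (e ∷ ds) {zero}  {suc x′}  eq _ = y₀ , refl , eh-≥ y₀ ds x′ eq
eh-mono y₀ (e ∷ ds) {suc x} {suc x′}  eq (s≤s le) = eh-mono y₀ ds eq le

nothing≢just : ∀ {a : ℕ} → nothing ≢ just a
nothing≢just ()

eh-mono-≤ : ∀ y₀ ds {x x′ a a′} → eh y₀ ds x ≡ just a → eh y₀ ds x′ ≡ just a′ → x ≤ x′ → a ≤ a′
eh-mono-≤ y₀ ds eq eq′ le with eh-mono y₀ ds eq′ le
... | _ , eq″ , a≤a′ with refl ← trans (sym eq) eq″ = a≤a′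

module Region (u l : List Dir) where

  InRegion : ℕ → ℕ → Set
  InRegion X Y = Σ ℕ λ a → Σ ℕ λ b →
    eh 0 l X ≡ just a × eh 0 u X ≡ just b × a ≤ Y × Y ℕ.< b

  region-rows : ∀ {X₁ X₂ X Y} → InRegion X₁ Y → InRegion X₂ Y → X₁ ≤ X → X ≤ X₂ → InRegion X Y
  region-rows (_ , b₁ , _ , up₁ , _ , Y<b₁) (a₂ , b₂ , low₂ , up₂ , a₂≤Y , _) X₁≤X X≤X₂
    with eh-mono 0 l low₂ X≤X₂ | eh-mono 0 u up₂ X≤X₂
  ... | a , low , a≤a₂ | b , up , _ =
    a , b , low , up , ℕP.≤-trans a≤a₂ a₂≤Y , ℕP.<-≤-trans Y<b₁ (eh-mono-≤ 0 u up₁ up X₁≤X)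

  region-cols : ∀ {X Y₁ Y₂ Y} → InRegion X Y₁ → InRegion X Y₂ → Y₁ ≤ Y → Y ≤ Y₂ → InRegion X Y
  region-cols (a , _ , low , _ , a≤Y₁ , _) (_ , b , _ , up , _ , Y₂<b) Y₁≤Y Y≤Y₂ =
    a , b , low , up , ℕP.≤-trans a≤Y₁ Y₁≤Y , ℕP.≤-<-trans Y≤Y₂ Y₂<b

  region-staircase : ∀ {X₁ Y₁ X₂ Y₂} → InRegion X₁ Y₁ → InRegion X₂ Y₂ → X₁ ≤ X₂ → Y₂ ≤ Y₁ →
    InRegion X₂ Y₁
  region-staircase (_ , b₁ , _ , up₁ , _ , Y₁<b₁) (a₂ , b₂ , low₂ , up₂ , a₂≤Y₂ , _) X₁≤X₂ Y₂≤Y₁ =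
    a₂ , b₂ , low₂ , up₂ , ℕP.≤-trans a₂≤Y₂ Y₂≤Y₁ , ℕP.<-≤-trans Y₁<b₁ (eh-mono-≤ 0 u up₁ up₂ X₁≤X₂)

  region? : ∀ X Y → Dec (InRegion X Y)
  region? X Y with eh 0 l X | eh 0 u X
  ... | nothing | _       = no λ (_ , _ , low′ , _) → nothing≢just low′
  ... | just _  | nothing = no λ (_ , _ , _ , up′ , _) → nothing≢just up′
  ... | just a  | just b with a ℕ.≤? Y | Y ℕ.<? b
  ...   | yes a≤Y | yes Y<b = yes (a , b , refl , refl , a≤Y , Y<b)
  ...   | no  a≰Y | _       = no λ (_ , _ , low′ , _ , a′≤Y , _) →
                                a≰Y (subst (_≤ Y) (sym (just-injective low′)) a′≤Y)
  ...   | yes _   | no Y≮b  = no λ (_ , _ , _ , up′ , _ , Y<b′) →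
                                Y≮b (subst (Y ℕ.<_) (sym (just-injective up′)) Y<b′)

module ParallelogramGeometry (P : Cell → Set) (ox oy : ℤ) (u l : List Dir)
       (P⇔ : ∀ c → P c ⇔ Inside (ox , oy) u l c) where
  open Region u l

  coordinates : ∀ {x y} → P (x , y) →
    Σ ℕ λ X → Σ ℕ λ Y → x ≡ ox ℤ.+ + X × y ≡ oy ℤ.+ + Y × InRegion X Y
  coordinates p with Equivalence.to (P⇔ _) p
  ... | X , Y , a , b , x≡ , y≡ , rest = X , Y , x≡ , y≡ , (a , b , rest)

  at : ∀ {X Y} → InRegion X Y → P (ox ℤ.+ + X , oy ℤ.+ + Y)
  at (a , b , rest) = Equivalence.from (P⇔ _) (_ , _ , a , b , refl , refl , rest)

  at⁻¹ : ∀ {X Y} → P (ox ℤ.+ + X , oy ℤ.+ + Y) → InRegion X Y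
  at⁻¹ p with coordinates p
  ... | _ , _ , x≡ , y≡ , r with refl ← shift-cancel ox x≡ | refl ← shift-cancel oy y≡ = r

  between : ∀ o {X₁ X₂ x} → o ℤ.+ + X₁ ℤ.≤ x → x ℤ.≤ o ℤ.+ + X₂ →
    Σ ℕ λ X → x ≡ o ℤ.+ + X × X₁ ≤ X × X ≤ X₂
  between o {X₁} lower upper with ≤⇒shift lower
  ... | m , refl = X₁ ℕ.+ m , shift-+ o X₁ m , ℕP.m≤m+n X₁ m ,
                   shift-cancel-≤ o (subst (ℤ._≤ _) (shift-+ o X₁ m) upper)

  rows : RowsConnected P
  rows y x₁ x₂ x p₁ p₂ x₁≤x x≤x₂ with coordinates p₁ | coordinates p₂
  ... | X₁ , Y , refl , refl , r₁ | X₂ , _ , refl , y≡ , r₂ with refl ← shift-cancel oy y≡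
                                                           with between ox x₁≤x x≤x₂
  ... | X , refl , X₁≤X , X≤X₂ = at (region-rows r₁ r₂ X₁≤X X≤X₂)

  cols : ColumnsConnected P
  cols x y₁ y₂ y p₁ p₂ y₁≤y y≤y₂ with coordinates p₁ | coordinates p₂
  ... | X , Y₁ , refl , refl , r₁ | _ , Y₂ , x≡ , refl , r₂ with refl ← shift-cancel ox x≡
                                                           with between oy y₁≤y y≤y₂
  ... | Y , refl , Y₁≤Y , Y≤Y₂ = at (region-cols r₁ r₂ Y₁≤Y Y≤Y₂)

  staircase : ∀ {x₁ y₁ x₂ y₂} → P (x₁ , y₁) → P (x₂ , y₂) → x₁ ℤ.≤ x₂ → y₂ ℤ.≤ y₁ → P (x₂ , y₁)
  staircase p₁ p₂ x₁≤x₂ y₂≤y₁ with coordinates p₁ | coordinates p₂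
  ... | X₁ , Y₁ , refl , refl , r₁ | X₂ , Y₂ , refl , refl , r₂ =
    at (region-staircase r₁ r₂ (shift-cancel-≤ ox x₁≤x₂) (shift-cancel-≤ oy y₂≤y₁))

  shifted? : ∀ o x → Dec (Σ ℕ λ X → x ≡ o ℤ.+ + X)
  shifted? o x with o ℤP.≤? x
  ... | yes o≤x = yes (≤⇒shift o≤x)
  ... | no  o≰x = no λ (X , x≡) → o≰x (subst (o ℤ.≤_) (sym x≡) (ℤP.i≤i+j o (+ X)))

  P? : ∀ c → Dec (P c)
  P? (x , y) with shifted? ox x | shifted? oy y
  ... | no x≠ | _     = no λ p → let X , _ , x≡ , _ = coordinates p in x≠ (X , x≡)
  ... | yes _ | no y≠ = no λ p → let _ , Y , _ , y≡ , _ = coordinates p in y≠ (Y , y≡)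
  ... | yes (X , refl) | yes (Y , refl) = map′ at at⁻¹ (region? X Y)

within-budget : ∀ k {x} → x ≤ 1 → (k ≡ 0 → x ≡ 0) → x ≤ k
within-budget zero    _   vanish = ℕP.≤-reflexive (vanish refl)
within-budget (suc k) x≤1 _      = ℕP.≤-trans x≤1 (s≤s z≤n)

run-bound : ∀ h b j {X} → j ≡ 0 ⊎ 1 ≤ X → changes (h ∷ replicate j b) ≤ X
run-bound h b zero    _           = z≤n
run-bound h b (suc j) (inj₂ 1≤X) =
  ℕP.≤-trans (ℕP.≤-reflexive (trans (cong (turn h b ℕ.+_) (changes-run b j)) (ℕP.+-identityʳ _)))
             (ℕP.≤-trans (turn≤1 h b) 1≤X)

empty-or-positive : ∀ X {j} → (X ≡ 0 → j ≡ 0) → j ≡ 0 ⊎ 1 ≤ X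
empty-or-positive zero    empty = inj₁ (empty refl)
empty-or-positive (suc X) _     = inj₂ (s≤s z≤n)

NEPath : (Cell → Set) → Cell → Cell → List Dir → Set
NEPath P c d ds = All IsNE ds × All P (trace c ds) × endOf c ds ≡ d

module StaircaseSet (P : Cell → Set) (rows : RowsConnected P) (cols : ColumnsConnected P)
  (staircase : ∀ {x₁ y₁ x₂ y₂} → P (x₁ , y₁) → P (x₂ , y₂) → x₁ ℤ.≤ x₂ → y₂ ℤ.≤ y₁ → P (x₂ , y₁))
  (E : Cell) (E-max : ∀ d → P d → d ≼ E) where

  extend : ∀ {a c d p} → IsNE a → P c → NEPath P (mv a c) d p → NEPath P c d (a ∷ p)
  extend isNE Pc (ne , inside , end) = isNE ∷ ne , Pc ∷ inside , end

  -- a straight run lies in P when each of its cells does; by convexity it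
  -- suffices that both ends do (east-run, north-run, south-run)
  run-inside : ∀ a j c → (∀ i → i ≤ j → P (endOf c (replicate i a))) → All P (trace c (replicate j a))
  run-inside a zero    c inside = inside 0 z≤n ∷ []
  run-inside a (suc j) c inside = inside 0 z≤n ∷ run-inside a j (mv a c) λ i i≤j → inside (suc i) (s≤s i≤j)

  east-run : ∀ {x y} j → P (x , y) → P (x ℤ.+ + j , y) →
    NEPath P (x , y) (x ℤ.+ + j , y) (replicate j e)
  east-run {x} {y} j p q =
    replicate⁺ j (inj₂ refl) ,
    run-inside e j (x , y) (λ i i≤j → subst P (sym (endOf-run-e i x y))
      (rows y x (x ℤ.+ + j) (x ℤ.+ + i) p q (ℤP.i≤i+j x (+ i)) (shift-mono-≤ x i≤j))) ,
    endOf-run-e j x y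

  north-run : ∀ {x y} j → P (x , y) → P (x , y ℤ.+ + j) →
    NEPath P (x , y) (x , y ℤ.+ + j) (replicate j n)
  north-run {x} {y} j p q =
    replicate⁺ j (inj₁ refl) ,
    run-inside n j (x , y) (λ i i≤j → subst P (sym (endOf-run-n i x y))
      (cols x y (y ℤ.+ + j) (y ℤ.+ + i) p q (ℤP.i≤i+j y (+ i)) (shift-mono-≤ y i≤j))) ,
    endOf-run-n j x y

  south-run : ∀ {x y} j → P (x , y) → P (x , y ℤ.- + j) →
    All P (trace (x , y) (replicate j s)) × endOf (x , y) (replicate j s) ≡ (x , y ℤ.- + j)
  south-run {x} {y} j p q =
    run-inside s j (x , y) (λ i i≤j → subst P (sym (endOf-run-s i x y))
      (cols x (y ℤ.- + j) y (y ℤ.- + i) q p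
        (ℤP.+-monoʳ-≤ y (ℤP.neg-mono-≤ (ℤ.+≤+ i≤j))) (ℤP.i-j≤i y (+ i)))) ,
    endOf-run-s j x y

  -- Let ds be a north-east path inside P from g to E.  Any cells
  -- c ≼ d of P with g ≼ c are joined by a north-east path inside P which,
  -- preceded by a step h, has no more changes than ds preceded by h: skip the
  -- guide's steps until it reaches c's row or column, then copy its turns
  -- (the staircase move keeps the copy inside P) and end with a straight run,
  -- which is only nonempty when the guide still has a turn left.
  Shadow : Dir → Cell → Cell → List Dir → Set
  Shadow h c d ds = Σ (List Dir) λ p → NEPath P c d p × changes (h ∷ p) ≤ changes (h ∷ ds)

  shadow       : ∀ h ds {g c d} → NEPath P g E ds → P c → P d → g ≼ c → c ≼ d →
                 Shadow h c d ds
  shadow-east  : ∀ h ds {g c d} → NEPath P (mv e g) E ds → P c → P d → g ≼ c → c ≼ d →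
                 Shadow h c d (e ∷ ds)
  shadow-north : ∀ h ds {g c d} → NEPath P (mv n g) E ds → P c → P d → g ≼ c → c ≼ d →
                 Shadow h c d (n ∷ ds)

  shadow h []        (_ , _ , refl) Pc Pd g≼c c≼d =
    [] , ([] , Pc ∷ [] , ≼-antisym c≼d (≼-trans (E-max _ Pd) g≼c)) , z≤n
  shadow h (.e ∷ ds) (inj₂ refl ∷ ne , _ ∷ inside , end) = shadow-east h ds (ne , inside , end)
  shadow h (.n ∷ ds) (inj₁ refl ∷ ne , _ ∷ inside , end) = shadow-north h ds (ne , inside , end)

  shadow-east h ds {gx , gy} {cx , cy} {dx , dy} guide Pc Pd (gx≤cx , gy≤cy) (cx≤dx , cy≤dy)
    with ≤⇒+1≤⊎≡ gx≤cx
  ... | inj₁ gx<cx =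
    let p , path , bound = shadow h ds guide Pc Pd (gx<cx , gy≤cy) (cx≤dx , cy≤dy)
    in  p , path , ℕP.≤-trans bound (changes-delete h e ds)
  ... | inj₂ refl with ≤⇒+1≤⊎≡ cx≤dx
  ...   | inj₁ cx<dx =
    let Pc⁺ = staircase Pc (All-head _ ds (proj₁ (proj₂ guide))) (ℤP.<⇒≤ (i<i+1 gx)) gy≤cy
        p , path , bound = shadow e ds guide Pc⁺ Pd (ℤP.≤-refl , gy≤cy) (cx<dx , cy≤dy)
    in  e ∷ p , extend (inj₂ refl) Pc path , ℕP.+-monoʳ-≤ (turn h e) bound
  ...   | inj₂ refl with ≤⇒shift cy≤dy
  ...     | j , refl =
    replicate j n , north-run j Pc Pd ,
    ℕP.≤-trans (run-bound h n j (empty-or-positive (changes (e ∷ ds)) flat)) (ℕP.m≤n+m _ (turn h e))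
    where
    -- a guide running straight east from g keeps E in g's row, leaving no room above c
    flat : changes (e ∷ ds) ≡ 0 → j ≡ 0
    flat straight = no-room j gy≤cy (subst (cy ℤ.+ + j ℤ.≤_) E-row (proj₂ (E-max _ Pd)))
      where
      E-row : proj₂ E ≡ gy
      E-row = trans (cong proj₂ (sym (proj₂ (proj₂ guide))))
                    (row-of-east-run (gx ℤ.+ + 1 , gy) ds (changes≡0⇒constant e ds straight))

  shadow-north h ds {gx , gy} {cx , cy} {dx , dy} guide Pc Pd (gx≤cx , gy≤cy) (cx≤dx , cy≤dy)
    with ≤⇒+1≤⊎≡ gy≤cy
  ... | inj₁ gy<cy =
    let p , path , bound = shadow h ds guide Pc Pd (gx≤cx , gy<cy) (cx≤dx , cy≤dy)
    in  p , path , ℕP.≤-trans bound (changes-delete h n ds)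
  ... | inj₂ refl with ≤⇒+1≤⊎≡ cy≤dy
  ...   | inj₁ cy<dy =
    let Pc⁺ = staircase (All-head _ ds (proj₁ (proj₂ guide))) Pc gx≤cx (ℤP.<⇒≤ (i<i+1 gy))
        p , path , bound = shadow n ds guide Pc⁺ Pd (gx≤cx , ℤP.≤-refl) (cx≤dx , cy<dy)
    in  n ∷ p , extend (inj₁ refl) Pc path , ℕP.+-monoʳ-≤ (turn h n) bound
  ...   | inj₂ refl with ≤⇒shift cx≤dx
  ...     | j , refl =
    replicate j e , east-run j Pc Pd ,
    ℕP.≤-trans (run-bound h e j (empty-or-positive (changes (n ∷ ds)) flat)) (ℕP.m≤n+m _ (turn h n))
    where
    -- a guide running straight north from g keeps E in g's column
    flat : changes (n ∷ ds) ≡ 0 → j ≡ 0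
    flat straight = no-room j gx≤cx (subst (cx ℤ.+ + j ℤ.≤_) E-column (proj₁ (E-max _ Pd)))
      where
      E-column : proj₁ E ≡ gx
      E-column = trans (cong proj₁ (sym (proj₂ (proj₂ guide))))
                       (column-of-north-run (gx , gy ℤ.+ + 1) ds (changes≡0⇒constant n ds straight))

  module Guided (S : Cell) (S-min : ∀ d → P d → S ≼ d)
                (k : ℕ) (ds : List Dir) (guide : NEPath P S E ds) (few : changes ds ≤ k) where

    ne-route : ∀ {c d} → P c → P d → c ≼ d → Route k P c d
    ne-route Pc Pd c≼d =
      let p , (ne , inside , end) , bound = shadow (leading n ds) ds guide Pc Pd (S-min _ Pc) c≼d
      in  p , inside , end , inj₁ ne ,
          ℕP.≤-trans (changes-tail _ p) (ℕP.≤-trans bound (subst (_≤ k) (sym (changes-leading n ds)) few))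

    straight : ∀ ds → NEPath P S E ds → changes ds ≡ 0 →
               (∀ {c} → P c → proj₁ c ≡ proj₁ S) ⊎ (∀ {c} → P c → proj₂ c ≡ proj₂ S)
    straight []        (_ , _ , refl) none = inj₁ λ Pc → ℤP.≤-antisym (proj₁ (E-max _ Pc)) (proj₁ (S-min _ Pc))
    straight (n ∷ ds′) (_ , _ , refl) none = inj₁ λ Pc → ℤP.≤-antisym
          (subst (_ ℤ.≤_) (column-of-north-run (mv n S) ds′ (changes≡0⇒constant n ds′ none)) (proj₁ (E-max _ Pc)))
          (proj₁ (S-min _ Pc))
    straight (e ∷ ds′) (_ , _ , refl) none = inj₂ λ Pc → ℤP.≤-antisym
          (subst (_ ℤ.≤_) (row-of-east-run (mv e S) ds′ (changes≡0⇒constant e ds′ none)) (proj₂ (E-max _ Pc)))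
          (proj₂ (S-min _ Pc))
    straight (s ∷ _)   (inj₁ () ∷ _ , _) _
    straight (s ∷ _)   (inj₂ () ∷ _ , _) _
    straight (w ∷ _)   (inj₁ () ∷ _ , _) _
    straight (w ∷ _)   (inj₂ () ∷ _ , _) _

    -- pairs in north-west/south-east position: go east to the staircase corner, then south
    nw-route : ∀ {cx cy dx dy} → P (cx , cy) → P (dx , dy) → cx ℤ.≤ dx → dy ℤ.≤ cy →
               Route k P (cx , cy) (dx , dy)
    nw-route {cx} {cy} {dx} {dy} Pc Pd cx≤dx dy≤cy with ≤⇒shift cx≤dx | ≤⇒shift dy≤cy
    ... | m , refl | j , refl =
      replicate m e ++ replicate j s ,
      All-trace-++ (cx , dy ℤ.+ + j) (replicate m e) (replicate j s) (proj₁ (proj₂ east))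
        (subst (λ t → All P (trace t (replicate j s))) (sym (proj₂ (proj₂ east))) (proj₁ south)) ,
      trans (endOf-++ (cx , dy ℤ.+ + j) (replicate m e) (replicate j s))
        (trans (cong (λ t → endOf t (replicate j s)) (proj₂ (proj₂ east)))
               (trans (proj₂ south) (cong (_ ,_) (shift-back dy (+ j))))) ,
      inj₂ (inj₂ (inj₁ (++⁺ (replicate⁺ m (inj₂ refl)) (replicate⁺ j (inj₁ refl))))) ,
      within-budget k (changes-two-runs e s m j) one-run-if-straight
      where
      corner : P (cx ℤ.+ + m , dy ℤ.+ + j)
      corner = staircase Pc Pd cx≤dx dy≤cy
      east : NEPath P (cx , dy ℤ.+ + j) (cx ℤ.+ + m , dy ℤ.+ + j) (replicate m e)
      east = east-run m Pc corner
      south : All P (trace (cx ℤ.+ + m , dy ℤ.+ + j) (replicate j s)) ×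
              endOf (cx ℤ.+ + m , dy ℤ.+ + j) (replicate j s) ≡ (cx ℤ.+ + m , (dy ℤ.+ + j) ℤ.- + j)
      south = south-run j corner (subst (λ t → P (cx ℤ.+ + m , t)) (sym (shift-back dy (+ j))) Pd)
      -- for k = 0 the guide is straight, so P is one row or column and a run is empty
      one-run-if-straight : k ≡ 0 → changes (replicate m e ++ replicate j s) ≡ 0
      one-run-if-straight refl with straight ds guide (ℕP.n≤0⇒n≡0 few)
      ... | inj₁ column rewrite shift-zero cx (trans (column Pd) (sym (column Pc))) = changes-replicate s j
      ... | inj₂ row    rewrite shift-zero dy (trans (row Pc) (sym (row Pd)))
                              | ++-identityʳ (replicate m e) = changes-replicate e m

    route : ∀ c d → P c → P d → Route k P c d
    route (cx , cy) (dx , dy) Pc Pd with ℤP.≤-total cx dx | ℤP.≤-total cy dy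
    ... | inj₁ cx≤dx | inj₁ cy≤dy = ne-route Pc Pd (cx≤dx , cy≤dy)
    ... | inj₂ dx≤cx | inj₂ dy≤cy = route-reverse (ne-route Pd Pc (dx≤cx , dy≤cy))
    ... | inj₁ cx≤dx | inj₂ dy≤cy = nw-route Pc Pd cx≤dx dy≤cy
    ... | inj₂ dx≤cx | inj₁ cy≤dy = route-reverse (nw-route Pd Pc dx≤cx cy≤dy)

  -- Greedification: every north-east path from a cell c to E can be replaced
  -- by one whose sides all have maximal length, without adding changes.
  -- Going straight on whenever P allows it is justified by shadowing the old
  -- path from the next cell; the number of steps to E is the fuel.
  module Greedification (P? : ∀ c → Dec (P c)) (PE : P E) where

    -- G continues a path that arrived at c by a step a, and all sides of a ∷ G
    -- (read from the cell before c) are maximal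
    MaximalAfter : Dir → Cell → List Dir → Set
    MaximalAfter a c []      = ¬ P (mv a c)
    MaximalAfter a c (b ∷ G) = (if same a b then ⊤ else ¬ P (mv a c)) × MaximalSides P c (b ∷ G)

    maximal-after : ∀ a c G → MaximalAfter a (mv a c) G → MaximalSides P c (a ∷ G)
    maximal-after a c []      maximal = maximal
    maximal-after a c (_ ∷ _) maximal = maximal

    maximal-straight : ∀ a c G → IsNE a → MaximalAfter a (mv a c) G → MaximalAfter a c (a ∷ G)
    maximal-straight .n c G (inj₁ refl) maximal = tt , maximal-after n c G maximal
    maximal-straight .e c G (inj₂ refl) maximal = tt , maximal-after e c G maximal

    if-false : ∀ {b} {A B : Set} → b ≡ false → B → if b then A else B
    if-false refl x = x

    Greedified : Dir → Cell → List Dir → Set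
    Greedified a c p = Σ (List Dir) λ G →
      NEPath P c E G × MaximalAfter a c G × changes (a ∷ G) ≤ changes (a ∷ p)

    greedify : ∀ N a {c} p → length p ≡ N → IsNE a → P c → NEPath P c E p → Greedified a c p
    go-on    : ∀ N a {c} p → length p ≡ N → IsNE a → P c → NEPath P c E p → P (mv a c) →
               Greedified a c p
    turn-off : ∀ N a {c} p → length p ≡ N → IsNE a → P c → NEPath P c E p → ¬ P (mv a c) →
               Greedified a c p

    greedify N a {c} p len isNE Pc path with P? (mv a c)
    ... | yes Pnext  = go-on    N a p len isNE Pc path Pnext
    ... | no blocked = turn-off N a p len isNE Pc path blocked

    go-on N a {c} p len isNE Pc path@(ne , _ , end) Pnext
      with shadow a p path Pnext PE (≼-step a c isNE) (E-max _ Pnext)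
    ... | p̂ , patĥ@(nê , _ , end̂) , bound
      with trans (sym len) (ne-length-determined c p (a ∷ p̂) ne (isNE ∷ nê) (trans end (sym end̂)))
    go-on zero    a p len isNE Pc path Pnext | _ | ()
    go-on (suc N) a {c} p len isNE Pc path Pnext | p̂ , patĥ , bound | N≡ =
      let G , pathG , maximal , boundG = greedify N a p̂ (sym (ℕP.suc-injective N≡)) isNE Pnext patĥ
      in  a ∷ G , extend isNE Pc pathG , maximal-straight a c G isNE maximal ,
          subst (_≤ changes (a ∷ p)) (sym (changes-dup a G)) (ℕP.≤-trans boundG bound)

    turn-off N       a []      _   _    Pc (_ , _ , end) blocked = [] , ([] , Pc ∷ [] , end) , blocked , z≤n
    turn-off zero    a (b ∷ p) ()
    turn-off (suc N) a {c} (b ∷ p) len isNE Pc (isNEb ∷ ne , _ ∷ inside , end) blocked with same a b in eq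
    ... | true with refl ← same⇒≡ a b eq = ⊥-elim (blocked (All-head _ p inside))
    ... | false =
      let G , pathG , maximal , boundG =
            greedify N b p (ℕP.suc-injective len) isNEb (All-head _ p inside) (ne , inside , end)
      in  b ∷ G , extend isNEb Pc pathG , (if-false eq blocked , maximal-after b c G maximal) ,
          subst (_≤ suc (changes (b ∷ p))) (cong (λ t → (if t then 0 else 1) ℕ.+ changes (b ∷ G)) (sym eq))
                (s≤s boundG)

    greedy-from : ∀ {S} a p → IsNE a → P S → NEPath P S E (a ∷ p) →
                  Σ (List Dir) λ G → Greedy P S E a G × changes G ≤ changes (a ∷ p)
    greedy-from {S} a p isNE PS path@(_ , _ ∷ inside , _)
      with greedify (length (a ∷ p)) a (a ∷ p) refl isNE PS path
    ... | [] , _ , blocked , _ = ⊥-elim (blocked (All-head _ p inside))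
    ... | b ∷ G , pathG@(ne , insideG , end) , maximal , bound with same a b in eq
    ...   | false = ⊥-elim (proj₁ maximal (All-head _ p inside))
    ...   | true with refl ← same⇒≡ a b eq =
      a ∷ G ,
      ((insideG , monotone⇒unique S (a ∷ G) (inj₁ ne)) , end , ne , refl , proj₂ maximal) ,
      subst (changes (a ∷ G) ≤_) (changes-dup a p) bound

  nothing-above-E : ¬ P (mv n E)
  nothing-above-E Pabove = ℤP.<-irrefl refl (ℤP.<-≤-trans (i<i+1 (proj₂ E)) (proj₂ (E-max _ Pabove)))

greedy-path : ∀ {P S E d ds} → Greedy P S E d ds → NEPath P S E ds
greedy-path ((inside , _) , end , ne , _) = ne , inside , end

v-path : ∀ {P S E ds} → IsV P S E ds → NEPath P S E ds
v-path (inj₁ (_ , greedy)) = greedy-path greedy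
v-path (inj₂ (_ , greedy)) = greedy-path greedy

h-path : ∀ {P S E ds} → IsH P S E ds → NEPath P S E ds
h-path (inj₁ (_ , greedy)) = greedy-path greedy
h-path (inj₂ (_ , greedy)) = greedy-path greedy

VOrHWithin : ℕ → (Cell → Set) → Cell → Cell → Set
VOrHWithin k P S E = (Σ (List Dir) λ ds → IsV P S E ds × changes ds ≤ k) ⊎
                     (Σ (List Dir) λ ds → IsH P S E ds × changes ds ≤ k)

within⇒guide : ∀ {k P S E} → VOrHWithin k P S E → Σ (List Dir) λ ds → NEPath P S E ds × changes ds ≤ k
within⇒guide (inj₁ (ds , v , few)) = ds , v-path v , few
within⇒guide (inj₂ (ds , h , few)) = ds , h-path h , few

module Criterion (k : ℕ) (P : Cell → Set) (ox oy : ℤ) (u l : List Dir)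
                 (P⇔ : ∀ c → P c ⇔ Inside (ox , oy) u l c)
                 (S E : Cell) (S-extreme : IsS P S) (E-extreme : IsE P E) where
  open ParallelogramGeometry P ox oy u l P⇔
  open StaircaseSet P rows cols staircase E (proj₂ E-extreme)
  open Greedification P? (proj₁ E-extreme)

  sufficiency : IsParallelogram P → VOrHWithin k P S E → KParallelogram k P
  sufficiency par criterion = ((proj₁ par , rows , cols) , joins) , par
    where
    joins : ∀ c d → P c → P d → Joins k P c d
    joins c d Pc Pd = let ds , path , few = within⇒guide criterion in
      route⇒joins (Guided.route S (proj₂ S-extreme) k ds path few c d Pc Pd)

  -- a route from S to E with at most k changes is north-east and can be
  -- greedified without new changes, yielding v(P) or h(P)
  necessity : KParallelogram k P → VOrHWithin k P S E
  necessity ((_ , joins) , _) with joins S E (proj₁ S-extreme) (proj₁ E-extreme)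
  ... | p , (inside , _) , end , monotone , few =
    from-ne-path p (monotone-forward⇒ne S p monotone (subst (S ≼_) (sym end) (proj₂ S-extreme E (proj₁ E-extreme))) ,
                    inside , end) few
    where
    from-ne-path : ∀ p → NEPath P S E p → changes p ≤ k → VOrHWithin k P S E
    from-ne-path []      (_ , PS ∷ [] , refl) _ =
      inj₁ ([] , inj₂ (nothing-above-E , ((PS ∷ [] , [] ∷ []) , refl , [] , tt , tt)) , z≤n)
    from-ne-path (n ∷ p) path@(_ , _ ∷ inside , _) few =
      let G , greedy , bound = greedy-from n p (inj₁ refl) (proj₁ S-extreme) path
      in  inj₁ (G , inj₁ (All-head _ p inside , greedy) , ℕP.≤-trans bound few)
    from-ne-path (e ∷ p) path@(_ , _ ∷ inside , _) few =
      let G , greedy , bound = greedy-from e p (inj₂ refl) (proj₁ S-extreme) path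
      in  inj₂ (G , inj₁ (All-head _ p inside , greedy) , ℕP.≤-trans bound few)
    from-ne-path (s ∷ _) (inj₁ () ∷ _ , _) _
    from-ne-path (s ∷ _) (inj₂ () ∷ _ , _) _
    from-ne-path (w ∷ _) (inj₁ () ∷ _ , _) _
    from-ne-path (w ∷ _) (inj₂ () ∷ _ , _) _

mainTheorem5 : (k : ℕ) (P : Cell → Set) → IsParallelogram P →
    (S E : Cell) → IsS P S → IsE P E →
    KParallelogram k P ⇔
      ((Σ (List Dir) λ ds → IsV P S E ds × changes ds ≤ k) ⊎
       (Σ (List Dir) λ ds → IsH P S E ds × changes ds ≤ k))
mainTheorem5 k P par@(_ , (ox , oy) , u , l , _ , _ , _ , _ , P⇔) S E S-extreme E-extreme =
  mk⇔ necessity (sufficiency par)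
  where open Criterion k P ox oy u l P⇔ S E S-extreme E-extreme
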